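{- Order the possible parts of an overpartition by $1<\overline{1}<2<\overline{2}<3<\overline{3}<\cdots$. For an overpartition $\pi$, let $\widetilde{\mathrm{omex}}(\pi)=\overline{k}$, where $k$ is the smallest positive integer such that $\overline{k}$ is not a part of $\pi$. Let $\widetilde{m}(n)$ denote the number of overpartitions $\pi$ of $n$ such that every element of $\{1,\overline{1},2,\overline{2},\dots\}$ smaller than $\widetilde{\mathrm{omex}}(\pi)$ in this ordering occurs as a part of $\pi$. That is, if $\widetilde{\mathrm{omex}}(\pi)=\overline{k}$, then $1,\dots,k$ all occur as non-overlined parts and $\overline{1},\dots,\overline{k-1}$ all occur as overlined parts. Let $\widetilde{M}(q)=\sum_{n\ge0}\widetilde{m}(n)q^n$. Then $$\widetilde{M}(q)=\overline{P}(q)\bigl(f_0(q)-1\bigr),$$ where $\overline{P}(q)=\dfrac{(-q;q)_\infty}{(q;q)_\infty}$ and $f_0(q)=\displaystyle\sum_{n=0}^{\infty}\frac{q^{n^2}}{(-q;q)_n}$ is Ramanujan's fifth order mock theta function.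
   Context: For $|q|<1$, $(a;q)_L=\prod_{k=0}^{L-1}(1-aq^k)$ and $(a;q)_\infty=\lim_{L\to\infty}(a;q)_L$. An overpartition of $n$ is a partition of $n$ in which the first occurrence of each distinct part size may be overlined. The empty overpartition is the unique overpartition of $0$. The identity is an identity of formal power series in $q$. -}

module Defs where

open import Data.Nat as ℕ using (ℕ; zero; suc; _≤_; _<_; _≤?_; _∸_; NonZero)
open import Data.Nat.DivMod using (_/_; _%_)
open import Data.Integer as ℤ using (ℤ; +_; -_; _*_; _+_; _-_; -1ℤ; 1ℤ; 0ℤ)
open import Data.Bool using (Bool; true; false)
open import Data.Product using (Σ; _×_; _,_; ∃; proj₁; proj₂)
open import Data.Sum using (_⊎_)
open import Data.Fin using (Fin)
open import Data.List using (List; []; _∷_; map)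
open import Data.Nat.ListAction using (sum)
open import Data.List.Relation.Unary.All using (All)
open import Data.List.Relation.Unary.Linked using (Linked)
open import Data.List.Membership.Propositional using (_∈_)
open import Relation.Binary.PropositionalEquality using (_≡_)
open import Relation.Nullary using (¬_; yes; no)
open import Function.Definitions using (Injective)

-- Formal power series over ℤ, as coefficient sequences.

PS : Set
PS = ℕ → ℤ

sumBelow : (ℕ → ℤ) → ℕ → ℤ
sumBelow f zero    = 0ℤ
sumBelow f (suc n) = sumBelow f n + f n

oneS : PS
oneS zero    = 1ℤ
oneS (suc _) = 0ℤ

_·_ : PS → PS → PS
(f · g) n = sumBelow (λ i → f i * g (n ∸ i)) (suc n)

_⊖_ : PS → PS → PS
(f ⊖ g) n = f n - g n

shift : ℕ → PS → PS
shift s f n with s ≤? n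
... | yes _ = f (n ∸ s)
... | no  _ = 0ℤ

-- 1 + a q^k  (k ≥ 1 written as suc k')
onePlus : ℤ → ℕ → PS
onePlus a k' zero = 1ℤ
onePlus a k' (suc n) with suc n ℕ.≟ suc k'
... | yes _ = a
... | no  _ = 0ℤ

-- 1 / (1 - a q^k) = Σ_{j ≥ 0} a^j q^{j k}   (k = suc k')
geom : ℤ → ℕ → PS
geom a k' n with n % suc k' ℕ.≟ 0
... | yes _ = a ℤ.^ (n / suc k')
... | no  _ = 0ℤ

-- finite product F 1 · F 2 · ... · F m   (F k' is the k'+1 -th factor)
prodTo : (ℕ → PS) → ℕ → PS
prodTo F zero    = oneS
prodTo F (suc m) = prodTo F m · F m

-- infinite product ∏_{k ≥ 1} F k, where the k-th factor is ≡ 1 mod q^k;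
-- the coefficient of q^n is that of the (stabilised) partial product up to k = n.
prodInf : (ℕ → PS) → PS
prodInf F n = prodTo F n n

negqPoch : ℕ → PS
negqPoch m = prodTo (λ k' → onePlus 1ℤ k') m

invNegqPoch : ℕ → PS
invNegqPoch m = prodTo (λ k' → geom -1ℤ k') m

negqPochInf : PS
negqPochInf = prodInf (λ k' → onePlus 1ℤ k')

invqPochInf : PS
invqPochInf = prodInf (λ k' → geom 1ℤ k')

Pbar : PS
Pbar = negqPochInf · invqPochInf

-- Ramanujan's fifth order mock theta function f_0(q) = Σ_{m≥0} q^{m²}/(-q;q)_m.
-- Terms with m > N have q-adic order m² > N, so the coefficient of q^N
-- only involves m ≤ N.
f0 : PS
f0 N = sumBelow (λ m → shift (m ℕ.* m) (invNegqPoch m) N) (suc N)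

rhs : PS
rhs = Pbar · (f0 ⊖ oneS)

-- A part: (size , overlined?)
Part : Set
Part = ℕ × Bool

_≺_ : Part → Part → Set
(k , b) ≺ (k' , b') = (k < k') ⊎ ((k ≡ k') × (b ≡ false) × (b' ≡ true))

-- consecutive parts in a list (listed in non-increasing order): the next one
-- is strictly smaller, or equal and non-overlined (only the first occurrence
-- of a size may be overlined, so overlined parts are never repeated).
NextPart : Part → Part → Set
NextPart x y = (y ≺ x) ⊎ ((x ≡ y) × (proj₂ x ≡ false))

-- π is an overpartition of n, represented canonically as the list of its
-- parts in non-increasing order.
IsOverpartition : ℕ → List Part → Set
IsOverpartition n ps =
  All (λ p → 1 ≤ proj₁ p) ps × Linked NextPart ps × (sum (map proj₁ ps) ≡ n)

MTildeProp : List Part → Set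
MTildeProp ps =
  Σ ℕ λ k → (1 ≤ k) × ¬ ((k , true) ∈ ps)
    × (∀ j → 1 ≤ j → j < k → (j , true) ∈ ps)
    × (∀ j → 1 ≤ j → j ≤ k → (j , false) ∈ ps)

MTildeSet : ℕ → List Part → Set
MTildeSet n ps = IsOverpartition n ps × MTildeProp ps

HasCardinality : {A : Set} → (A → Set) → ℕ → Set
HasCardinality {A} P c =
  Σ (Fin c → A) λ f → Injective _≡_ _≡_ f × (∀ i → P (f i))
    × (∀ x → P x → ∃ λ i → f i ≡ x)

-- Prescribing for every part whether it is forbidden, optional or required makes the
-- generating function of the admissible overpartitions a product over part sizes j: the
-- non-overlined part j contributes 1/(1 - q^j), times q^j when it is required, and the
-- overlined part j contributes 1, 1 + q^j or q^j. Overpartitions with omex~ = k̄ are those in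
-- which every part below k̄ is required and k̄ is forbidden, so their generating function is
-- q^(k²) (-q;q)_∞ / ((q;q)_∞ (-q;q)_k); summing over k ≥ 1 gives P̄(q) (f₀(q) - 1).
--
-- The product formula comes from removing the largest part. A list bounded by a part B either
-- avoids B, and is then bounded by the predecessor of B, or starts with B. When B is the
-- non-overlined part j, removing it leaves a list that is again bounded by B, so the
-- generating function X satisfies X = Y + q^j X, that is X = Y / (1 - q^j).

module Submission where

open import Defs
open import Algebra.Bundles using (CommutativeMonoid)
import Algebra.Solver.CommutativeMonoid
open import Data.Bool as Bool using (Bool; true; false)
open import Data.Empty using (⊥; ⊥-elim)
open import Data.Fin as Fin using (Fin)
import Data.Fin.Properties as FinP
open import Data.Integer as ℤ using (ℤ; +_; -_; _+_; _*_; _-_; 0ℤ; 1ℤ; -1ℤ)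
import Data.Integer.Properties as ℤP
open import Data.Integer.Tactic.RingSolver using (solve-∀)
open import Data.List using (List; []; _∷_; map)
import Data.List.Properties as ListP
open import Data.List.Membership.Propositional using (_∈_; _∉_)
open import Data.List.Relation.Unary.All as All using (All; []; _∷_)
open import Data.List.Relation.Unary.Any using (here; there)
open import Data.List.Relation.Unary.Linked as Linked using (Linked; []; [-]; _∷_)
import Data.List.Relation.Unary.Linked.Properties as LinkedP
open import Data.Nat as ℕ using (ℕ; zero; suc; _∸_; _≤_; _<_; z≤n; s≤s; _≤?_)
open import Data.Nat.DivMod using (_%_; [m+n]%n≡m%n; m/n≡1+[m∸n]/n; m<n⇒m%n≡m)
open import Data.Nat.Induction using (<-rec)
open import Data.Nat.ListAction using (sum)
import Data.Nat.Properties as ℕP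
import Data.Nat.Tactic.RingSolver as ℕ-Solver
open import Data.Product using (Σ; ∃; _×_; _,_; proj₁; proj₂)
open import Data.Product.Properties using (≡-dec)
open import Data.Sum using (_⊎_; inj₁; inj₂)
open import Data.Unit using (⊤; tt)
open import Function using (_∘_)
open import Level using (0ℓ)
open import Relation.Binary.Definitions using (Trichotomous; tri<; tri≈; tri>)
open import Relation.Binary.PropositionalEquality
import Relation.Binary.Reasoning.Setoid
open import Relation.Nullary using (¬_; yes; no)

-- Finite sums

sumBelow-cong : ∀ {f g : ℕ → ℤ} n → (∀ {i} → i < n → f i ≡ g i) → sumBelow f n ≡ sumBelow g n
sumBelow-cong zero    f≡g = refl
sumBelow-cong (suc n) f≡g = cong₂ _+_ (sumBelow-cong n (f≡g ∘ ℕP.m<n⇒m<1+n)) (f≡g ℕP.≤-refl)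

sumBelow-zero : ∀ {f : ℕ → ℤ} n → (∀ {i} → i < n → f i ≡ 0ℤ) → sumBelow f n ≡ 0ℤ
sumBelow-zero n f≡0 = trans (sumBelow-cong {g = λ _ → 0ℤ} n f≡0) (zeros n)
  where
  zeros : ∀ n → sumBelow (λ _ → 0ℤ) n ≡ 0ℤ
  zeros zero    = refl
  zeros (suc n) = cong (_+ 0ℤ) (zeros n)

sumBelow-+ : ∀ (f g : ℕ → ℤ) n → sumBelow (λ i → f i + g i) n ≡ sumBelow f n + sumBelow g n
sumBelow-+ f g zero    = refl
sumBelow-+ f g (suc n) =
  trans (cong (_+ (f n + g n)) (sumBelow-+ f g n)) (interchange (sumBelow f n) (sumBelow g n) (f n) (g n))
  where
  interchange : ∀ a b c d → a + b + (c + d) ≡ a + c + (b + d)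
  interchange = solve-∀

sumBelow-*ˡ : ∀ a (f : ℕ → ℤ) n → sumBelow (λ i → a * f i) n ≡ a * sumBelow f n
sumBelow-*ˡ a f zero    = sym (ℤP.*-zeroʳ a)
sumBelow-*ˡ a f (suc n) =
  trans (cong (_+ a * f n) (sumBelow-*ˡ a f n)) (sym (ℤP.*-distribˡ-+ a (sumBelow f n) (f n)))

sumBelow-suc : ∀ (f : ℕ → ℤ) n → sumBelow f (suc n) ≡ f 0 + sumBelow (f ∘ suc) n
sumBelow-suc f zero    = ℤP.+-comm 0ℤ (f 0)
sumBelow-suc f (suc n) = trans (cong (_+ f (suc n)) (sumBelow-suc f n)) (ℤP.+-assoc (f 0) _ _)

sumBelow-split : ∀ (f : ℕ → ℤ) m k →
                 sumBelow f (m ℕ.+ k) ≡ sumBelow f m + sumBelow (λ i → f (m ℕ.+ i)) k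
sumBelow-split f m zero    = trans (cong (sumBelow f) (ℕP.+-identityʳ m)) (sym (ℤP.+-identityʳ _))
sumBelow-split f m (suc k) = begin
  sumBelow f (m ℕ.+ suc k)                                       ≡⟨ cong (sumBelow f) (ℕP.+-suc m k) ⟩
  sumBelow f (m ℕ.+ k) + f (m ℕ.+ k)                             ≡⟨ cong (_+ f (m ℕ.+ k)) (sumBelow-split f m k) ⟩
  sumBelow f m + sumBelow (λ i → f (m ℕ.+ i)) k + f (m ℕ.+ k)    ≡⟨ ℤP.+-assoc (sumBelow f m) _ _ ⟩
  sumBelow f m + sumBelow (λ i → f (m ℕ.+ i)) (suc k)            ∎
  where open ≡-Reasoning

sumBelow-vanishing : ∀ (f : ℕ → ℤ) {a b} → a ≤ b → (∀ {i} → a ≤ i → f i ≡ 0ℤ) →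
                     sumBelow f b ≡ sumBelow f a
sumBelow-vanishing f {a} {b} a≤b f≡0 = begin
  sumBelow f b                                         ≡⟨ cong (sumBelow f) (ℕP.m+[n∸m]≡n a≤b) ⟨
  sumBelow f (a ℕ.+ (b ∸ a))                           ≡⟨ sumBelow-split f a (b ∸ a) ⟩
  sumBelow f a + sumBelow (λ i → f (a ℕ.+ i)) (b ∸ a)  ≡⟨ cong (_+_ (sumBelow f a)) tail≡0 ⟩
  sumBelow f a + 0ℤ                                    ≡⟨ ℤP.+-identityʳ _ ⟩
  sumBelow f a                                         ∎
  where
  open ≡-Reasoning
  tail≡0 : sumBelow (λ i → f (a ℕ.+ i)) (b ∸ a) ≡ 0ℤ
  tail≡0 = sumBelow-zero (b ∸ a) (λ {i} _ → f≡0 (ℕP.m≤m+n a i))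

sumBelow-reverse : ∀ (f : ℕ → ℤ) n → sumBelow f n ≡ sumBelow (λ i → f (n ∸ suc i)) n
sumBelow-reverse f zero    = refl
sumBelow-reverse f (suc n) = begin
  sumBelow f n + f n                           ≡⟨ cong (_+ f n) (sumBelow-reverse f n) ⟩
  sumBelow (λ i → f (n ∸ suc i)) n + f n       ≡⟨ ℤP.+-comm _ (f n) ⟩
  f n + sumBelow (λ i → f (n ∸ suc i)) n       ≡⟨ sumBelow-suc (λ i → f (suc n ∸ suc i)) n ⟨
  sumBelow (λ i → f (suc n ∸ suc i)) (suc n)   ∎
  where open ≡-Reasoning

sumBelow-swap : ∀ (A : ℕ → ℕ → ℤ) a b →
                sumBelow (λ i → sumBelow (A i) b) a ≡ sumBelow (λ j → sumBelow (λ i → A i j) a) b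
sumBelow-swap A a zero    = sumBelow-zero a (λ _ → refl)
sumBelow-swap A a (suc b) =
  trans (sumBelow-+ (λ i → sumBelow (A i) b) (λ i → A i b) a)
        (cong (_+ sumBelow (λ i → A i b) a) (sumBelow-swap A a b))

sumBelow-triangle : ∀ (A : ℕ → ℕ → ℤ) n →
  sumBelow (λ i → sumBelow (λ j → A j i) (suc i)) (suc n) ≡
  sumBelow (λ j → sumBelow (λ k → A j (j ℕ.+ k)) (suc (n ∸ j))) (suc n)
sumBelow-triangle A zero    = refl
sumBelow-triangle A (suc n) = begin
  Rows n + (Column n + A (suc n) (suc n))              ≡⟨ cong (_+ (Column n + A (suc n) (suc n))) (sumBelow-triangle A n) ⟩
  Cols n + (Column n + A (suc n) (suc n))              ≡⟨ ℤP.+-assoc (Cols n) (Column n) _ ⟨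
  (Cols n + Column n) + A (suc n) (suc n)              ≡⟨ cong₂ _+_ extend corner ⟩
  Cols′ + sumBelow (λ k → A (suc n) (suc n ℕ.+ k)) (suc (suc n ∸ suc n)) ∎
  where
  open ≡-Reasoning
  Rows Cols : ℕ → ℤ
  Rows n = sumBelow (λ i → sumBelow (λ j → A j i) (suc i)) (suc n)
  Cols n = sumBelow (λ j → sumBelow (λ k → A j (j ℕ.+ k)) (suc (n ∸ j))) (suc n)
  Column : ℕ → ℤ
  Column n = sumBelow (λ j → A j (suc n)) (suc n)
  Cols′ : ℤ
  Cols′ = sumBelow (λ j → sumBelow (λ k → A j (j ℕ.+ k)) (suc (suc n ∸ j))) (suc n)
  corner : A (suc n) (suc n) ≡ sumBelow (λ k → A (suc n) (suc n ℕ.+ k)) (suc (suc n ∸ suc n))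
  corner = begin
    A (suc n) (suc n)                                ≡⟨ cong (A (suc n)) (ℕP.+-identityʳ (suc n)) ⟨
    A (suc n) (suc n ℕ.+ 0)                          ≡⟨ ℤP.+-identityˡ _ ⟨
    sumBelow (λ k → A (suc n) (suc n ℕ.+ k)) 1
      ≡⟨ cong (λ m → sumBelow (λ k → A (suc n) (suc n ℕ.+ k)) (suc m)) (ℕP.n∸n≡0 n) ⟨
    sumBelow (λ k → A (suc n) (suc n ℕ.+ k)) (suc (suc n ∸ suc n)) ∎
  lengthen : ∀ {j} → j < suc n →
             sumBelow (λ k → A j (j ℕ.+ k)) (suc (n ∸ j)) + A j (suc n)
             ≡ sumBelow (λ k → A j (j ℕ.+ k)) (suc (suc n ∸ j))
  lengthen {j} j<sn = begin
    sumBelow g (suc (n ∸ j)) + A j (suc n)           ≡⟨ cong (λ i → sumBelow g (suc (n ∸ j)) + A j i) top ⟩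
    sumBelow g (suc (suc (n ∸ j)))                   ≡⟨ cong (λ m → sumBelow g (suc m)) (ℕP.+-∸-assoc 1 j≤n) ⟨
    sumBelow g (suc (suc n ∸ j))                     ∎
    where
    g : ℕ → ℤ
    g k = A j (j ℕ.+ k)
    j≤n : j ≤ n
    j≤n = ℕP.≤-pred j<sn
    top : suc n ≡ j ℕ.+ suc (n ∸ j)
    top = sym (trans (ℕP.+-suc j (n ∸ j)) (cong suc (ℕP.m+[n∸m]≡n j≤n)))
  extend : Cols n + Column n ≡ Cols′
  extend = trans (sym (sumBelow-+ (λ j → sumBelow (λ k → A j (j ℕ.+ k)) (suc (n ∸ j))) (λ j → A j (suc n)) (suc n)))
                 (sumBelow-cong (suc n) lengthen)

-- Formal power series

infix  4 _≈_ _≈[_]_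
infixl 6 _⊕_
infixr 7 _⋆_

record _≈_ (f g : PS) : Set where
  constructor coeffwise
  field coeff : ∀ n → f n ≡ g n
open _≈_ public

record _≈[_]_ (f : PS) (N : ℕ) (g : PS) : Set where
  constructor coeffwise≤
  field coeff≤ : ∀ {j} → j ≤ N → f j ≡ g j
open _≈[_]_ public

_⊕_ : PS → PS → PS
(f ⊕ g) n = f n + g n

_⋆_ : ℤ → PS → PS
(a ⋆ f) n = a * f n

zeroS : PS
zeroS _ = 0ℤ

≈⇒≈[] : ∀ {f g} N → f ≈ g → f ≈[ N ] g
≈⇒≈[] N f≈g = coeffwise≤ λ {j} _ → coeff f≈g j

≈[]-trans : ∀ {f g h N} → f ≈[ N ] g → g ≈[ N ] h → f ≈[ N ] h
≈[]-trans f≈g g≈h = coeffwise≤ λ j≤N → trans (coeff≤ f≈g j≤N) (coeff≤ g≈h j≤N)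

≈[]-refl : ∀ {f N} → f ≈[ N ] f
≈[]-refl = coeffwise≤ λ _ → refl

≈[]-weaken : ∀ {f g M N} → M ≤ N → f ≈[ N ] g → f ≈[ M ] g
≈[]-weaken M≤N f≈g = coeffwise≤ λ j≤M → coeff≤ f≈g (ℕP.≤-trans j≤M M≤N)

·-cong-≈[] : ∀ {f f′ g g′ N} → f ≈[ N ] f′ → g ≈[ N ] g′ → f · g ≈[ N ] f′ · g′
·-cong-≈[] f≈f′ g≈g′ = coeffwise≤ λ {j} j≤N → sumBelow-cong (suc j) λ {i} i<sj →
  cong₂ _*_ (coeff≤ f≈f′ (ℕP.≤-trans (ℕP.≤-pred i<sj) j≤N))
            (coeff≤ g≈g′ (ℕP.≤-trans (ℕP.m∸n≤m j i) j≤N))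

·-cong : ∀ {f f′ g g′} → f ≈ f′ → g ≈ g′ → f · g ≈ f′ · g′
·-cong f≈f′ g≈g′ = coeffwise λ n →
  coeff≤ (·-cong-≈[] (≈⇒≈[] n f≈f′) (≈⇒≈[] n g≈g′)) ℕP.≤-refl

·-comm : ∀ f g → f · g ≈ g · f
·-comm f g = coeffwise λ n → trans (sumBelow-reverse (λ i → f i * g (n ∸ i)) (suc n)) (sumBelow-cong (suc n) (swap n))
  where
  swap : ∀ n {i} → i < suc n → f (n ∸ i) * g (n ∸ (n ∸ i)) ≡ g i * f (n ∸ i)
  swap n {i} i<sn = trans (ℤP.*-comm (f (n ∸ i)) _)
                          (cong (λ j → g j * f (n ∸ i)) (ℕP.m∸[m∸n]≡n (ℕP.≤-pred i<sn)))

·-assoc : ∀ f g h → (f · g) · h ≈ f · (g · h)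
·-assoc f g h = coeffwise λ n → begin
  sumBelow (λ i → sumBelow (λ j → f j * g (i ∸ j)) (suc i) * h (n ∸ i)) (suc n)
    ≡⟨ sumBelow-cong (suc n) (λ {i} _ → distrib n i) ⟩
  sumBelow (λ i → sumBelow (λ j → f j * g (i ∸ j) * h (n ∸ i)) (suc i)) (suc n)
    ≡⟨ sumBelow-triangle (λ j i → f j * g (i ∸ j) * h (n ∸ i)) n ⟩
  sumBelow (λ j → sumBelow (λ k → f j * g (j ℕ.+ k ∸ j) * h (n ∸ (j ℕ.+ k))) (suc (n ∸ j))) (suc n)
    ≡⟨ sumBelow-cong (suc n) (λ {j} _ → trans (sumBelow-cong (suc (n ∸ j)) (λ {k} _ → reindex n j k))
                                              (sumBelow-*ˡ (f j) (λ k → g k * h (n ∸ j ∸ k)) (suc (n ∸ j)))) ⟩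
  sumBelow (λ j → f j * sumBelow (λ k → g k * h (n ∸ j ∸ k)) (suc (n ∸ j))) (suc n) ∎
  where
  open ≡-Reasoning
  distrib : ∀ n i → sumBelow (λ j → f j * g (i ∸ j)) (suc i) * h (n ∸ i)
                    ≡ sumBelow (λ j → f j * g (i ∸ j) * h (n ∸ i)) (suc i)
  distrib n i = trans (ℤP.*-comm _ (h (n ∸ i)))
    (trans (sym (sumBelow-*ˡ (h (n ∸ i)) (λ j → f j * g (i ∸ j)) (suc i)))
           (sumBelow-cong (suc i) (λ _ → ℤP.*-comm (h (n ∸ i)) _)))
  reindex : ∀ n j k → f j * g (j ℕ.+ k ∸ j) * h (n ∸ (j ℕ.+ k)) ≡ f j * (g k * h (n ∸ j ∸ k))
  reindex n j k = trans (cong₂ (λ a b → f j * g a * h b) (ℕP.m+n∸m≡n j k) (sym (ℕP.∸-+-assoc n j k)))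
                        (ℤP.*-assoc (f j) _ _)

·-identityˡ : ∀ f → oneS · f ≈ f
·-identityˡ f = coeffwise λ n → begin
  sumBelow (λ i → oneS i * f (n ∸ i)) (suc n)             ≡⟨ sumBelow-suc (λ i → oneS i * f (n ∸ i)) n ⟩
  1ℤ * f n + sumBelow (λ i → 0ℤ * f (n ∸ suc i)) n       ≡⟨ cong₂ _+_ (ℤP.*-identityˡ (f n))
                                                                       (sumBelow-zero n (λ _ → refl)) ⟩
  f n + 0ℤ                                                ≡⟨ ℤP.+-identityʳ (f n) ⟩
  f n                                                     ∎
  where open ≡-Reasoning

·-identityʳ : ∀ f → f · oneS ≈ f
·-identityʳ f = coeffwise λ n → trans (coeff (·-comm f oneS) n) (coeff (·-identityˡ f) n)

·-commutativeMonoid : CommutativeMonoid 0ℓ 0ℓ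
·-commutativeMonoid = record
  { Carrier = PS ; _≈_ = _≈_ ; _∙_ = _·_ ; ε = oneS
  ; isCommutativeMonoid = record
    { isMonoid = record
      { isSemigroup = record
        { isMagma = record
          { isEquivalence = record
            { refl  = coeffwise λ _ → refl
            ; sym   = λ f≈g → coeffwise λ n → sym (coeff f≈g n)
            ; trans = λ f≈g g≈h → coeffwise λ n → trans (coeff f≈g n) (coeff g≈h n) }
          ; ∙-cong = ·-cong }
        ; assoc = ·-assoc }
      ; identity = ·-identityˡ , ·-identityʳ }
    ; comm = ·-comm } }

open CommutativeMonoid ·-commutativeMonoid public
  using () renaming (refl to ≈-refl; reflexive to ≈-reflexive; sym to ≈-sym; trans to ≈-trans; setoid to ≈-setoid)
module ≈-Reasoning = Relation.Binary.Reasoning.Setoid ≈-setoid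
module ·-Solver = Algebra.Solver.CommutativeMonoid ·-commutativeMonoid

·-congˡ : ∀ {f f′} g → f ≈ f′ → f · g ≈ f′ · g
·-congˡ g f≈f′ = ·-cong f≈f′ (≈-refl {g})

·-congʳ : ∀ f {g g′} → g ≈ g′ → f · g ≈ f · g′
·-congʳ f g≈g′ = ·-cong (≈-refl {f}) g≈g′

·-distribˡ-⊕ : ∀ f g h → f · (g ⊕ h) ≈ f · g ⊕ f · h
·-distribˡ-⊕ f g h = coeffwise λ n →
  trans (sumBelow-cong (suc n) (λ {i} _ → ℤP.*-distribˡ-+ (f i) (g (n ∸ i)) (h (n ∸ i)))) (sumBelow-+ _ _ (suc n))

·-⋆ : ∀ f a g → f · (a ⋆ g) ≈ a ⋆ (f · g)
·-⋆ f a g = coeffwise λ n →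
  trans (sumBelow-cong (suc n) (λ {i} _ → swap a (f i) (g (n ∸ i)))) (sumBelow-*ˡ a _ (suc n))
  where
  swap : ∀ a x y → x * (a * y) ≡ a * (x * y)
  swap = solve-∀

⊕-cong : ∀ {f f′ g g′} → f ≈ f′ → g ≈ g′ → f ⊕ g ≈ f′ ⊕ g′
⊕-cong f≈f′ g≈g′ = coeffwise λ n → cong₂ _+_ (coeff f≈f′ n) (coeff g≈g′ n)

⋆-cong : ∀ a {f g} → f ≈ g → a ⋆ f ≈ a ⋆ g
⋆-cong a f≈g = coeffwise λ n → cong (a *_) (coeff f≈g n)

⊕-identityˡ : ∀ f → zeroS ⊕ f ≈ f
⊕-identityˡ f = coeffwise λ n → ℤP.+-identityˡ (f n)

⊕-identityʳ : ∀ f → f ⊕ zeroS ≈ f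
⊕-identityʳ f = coeffwise λ n → ℤP.+-identityʳ (f n)

⋆-identityˡ : ∀ f → 1ℤ ⋆ f ≈ f
⋆-identityˡ f = coeffwise λ n → ℤP.*-identityˡ (f n)

·-sumBelow : ∀ f (G : ℕ → PS) K →
             f · (λ j → sumBelow (λ m → G m j) K) ≈ (λ j → sumBelow (λ m → (f · G m) j) K)
·-sumBelow f G K = coeffwise λ n →
  trans (sumBelow-cong (suc n) (λ {i} _ → sym (sumBelow-*ˡ (f i) (λ m → G m (n ∸ i)) K)))
        (sumBelow-swap (λ i m → f i * G m (n ∸ i)) (suc n) K)

shift-< : ∀ {s n} (f : PS) → n < s → shift s f n ≡ 0ℤ
shift-< {s} {n} f n<s with s ≤? n
... | yes s≤n = ⊥-elim (ℕP.<⇒≱ n<s s≤n)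
... | no  _   = refl

shift-≥ : ∀ {s n} (f : PS) → s ≤ n → shift s f n ≡ f (n ∸ s)
shift-≥ {s} {n} f s≤n with s ≤? n
... | yes _   = refl
... | no  s≰n = ⊥-elim (s≰n s≤n)

shift-cong : ∀ s {f g} → f ≈ g → shift s f ≈ shift s g
shift-cong s {f} {g} f≈g = coeffwise go
  where
  go : ∀ n → shift s f n ≡ shift s g n
  go n with s ≤? n
  ... | yes _ = coeff f≈g (n ∸ s)
  ... | no  _ = refl

shift-+ : ∀ a b f → shift (a ℕ.+ b) f ≈ shift a (shift b f)
shift-+ a b f = coeffwise go
  where
  go : ∀ n → shift (a ℕ.+ b) f n ≡ shift a (shift b f) n
  go n with a ≤? n
  ... | no a≰n  = shift-< f (ℕP.<-≤-trans (ℕP.≰⇒> a≰n) (ℕP.m≤m+n a b))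
  ... | yes a≤n with b ≤? n ∸ a
  ...   | yes b≤n∸a = trans (shift-≥ f a+b≤n) (cong f (sym (ℕP.∸-+-assoc n a b)))
    where a+b≤n = subst (_≤ n) (ℕP.+-comm b a) (ℕP.m≤o∸n⇒m+n≤o b a≤n b≤n∸a)
  ...   | no b≰n∸a  = shift-< f (ℕP.≰⇒> a+b≰n)
    where a+b≰n = λ a+b≤n → b≰n∸a (ℕP.m+n≤o⇒m≤o∸n b (subst (_≤ n) (ℕP.+-comm a b) a+b≤n))

shift-·ˡ : ∀ s f g → shift s f · g ≈ shift s (f · g)
shift-·ˡ s f g = coeffwise go
  where
  term : ℕ → ℕ → ℤ
  term n i = shift s f i * g (n ∸ i)
  vanish : ∀ {n i} → i < s → term n i ≡ 0ℤ
  vanish {n} {i} i<s = trans (cong (_* g (n ∸ i)) (shift-< f i<s)) (ℤP.*-zeroˡ (g (n ∸ i)))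
  shifted : ∀ n i → term n (s ℕ.+ i) ≡ f i * g (n ∸ s ∸ i)
  shifted n i = cong₂ _*_ (trans (shift-≥ f (ℕP.m≤m+n s i)) (cong f (ℕP.m+n∸m≡n s i)))
                          (cong g (sym (ℕP.∸-+-assoc n s i)))
  go : ∀ n → (shift s f · g) n ≡ shift s (f · g) n
  go n with ℕP.≤-<-connex s n
  ... | inj₂ n<s = trans (sumBelow-zero (suc n) (λ i<sn → vanish (ℕP.<-≤-trans i<sn n<s))) (sym (shift-< (f · g) n<s))
  ... | inj₁ s≤n = begin
    sumBelow (term n) (suc n)
      ≡⟨ cong (sumBelow (term n)) n+1≡s+[n-s+1] ⟩
    sumBelow (term n) (s ℕ.+ suc (n ∸ s))
      ≡⟨ sumBelow-split (term n) s (suc (n ∸ s)) ⟩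
    sumBelow (term n) s + sumBelow (λ i → term n (s ℕ.+ i)) (suc (n ∸ s))
      ≡⟨ cong₂ _+_ (sumBelow-zero s vanish) (sumBelow-cong (suc (n ∸ s)) (λ {i} _ → shifted n i)) ⟩
    0ℤ + (f · g) (n ∸ s)
      ≡⟨ ℤP.+-identityˡ _ ⟩
    (f · g) (n ∸ s)
      ≡⟨ shift-≥ (f · g) s≤n ⟨
    shift s (f · g) n ∎
    where
    open ≡-Reasoning
    n+1≡s+[n-s+1] : suc n ≡ s ℕ.+ suc (n ∸ s)
    n+1≡s+[n-s+1] = sym (trans (ℕP.+-suc s (n ∸ s)) (cong suc (ℕP.m+[n∸m]≡n s≤n)))

·-shift : ∀ s f g → f · shift s g ≈ shift s (f · g)
·-shift s f g = ≈-trans (·-comm f (shift s g)) (≈-trans (shift-·ˡ s g f) (shift-cong s (·-comm g f)))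

mono : ℕ → PS
mono s = shift s oneS

mono-· : ∀ s f → mono s · f ≈ shift s f
mono-· s f = ≈-trans (shift-·ˡ s oneS f) (shift-cong s (·-identityˡ f))

·-mono : ∀ f s → f · mono s ≈ shift s f
·-mono f s = ≈-trans (·-comm f (mono s)) (mono-· s f)

mono-+ : ∀ a b → mono (a ℕ.+ b) ≈ mono a · mono b
mono-+ a b = ≈-trans (shift-+ a b oneS) (≈-sym (mono-· a (mono b)))

mono-zero : mono 0 ≈ oneS
mono-zero = coeffwise λ n → shift-≥ oneS z≤n

mono-+-+ : ∀ a b c → (mono a · mono b) · mono c ≈ mono (a ℕ.+ b ℕ.+ c)
mono-+-+ a b c = ≈-sym (≈-trans (mono-+ (a ℕ.+ b) c) (·-congˡ (mono c) (mono-+ a b)))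

mono-diag : ∀ s → mono s s ≡ 1ℤ
mono-diag s = trans (shift-≥ {s} oneS ℕP.≤-refl) (cong oneS (ℕP.n∸n≡0 s))

mono-off : ∀ {s n} → n ≢ s → mono s n ≡ 0ℤ
mono-off {s} {n} n≢s with s ≤? n
... | no  _   = refl
... | yes s≤n = oneS-nonzero (λ n∸s≡0 → n≢s (ℕP.≤-antisym (ℕP.m∸n≡0⇒m≤n n∸s≡0) s≤n))
  where
  oneS-nonzero : ∀ {m} → m ≢ 0 → oneS m ≡ 0ℤ
  oneS-nonzero {zero}  m≢0 = ⊥-elim (m≢0 refl)
  oneS-nonzero {suc m} _   = refl

onePlus-≈ : ∀ a s → onePlus a s ≈ oneS ⊕ a ⋆ mono (suc s)
onePlus-≈ a s = coeffwise go
  where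
  go : ∀ n → onePlus a s n ≡ oneS n + a * mono (suc s) n
  go zero = sym (trans (cong (λ x → 1ℤ + a * x) (shift-< {suc s} oneS (s≤s z≤n))) (cong (_+_ 1ℤ) (ℤP.*-zeroʳ a)))
  go (suc n) with suc n ℕ.≟ suc s
  ... | yes refl = sym (trans (ℤP.+-identityˡ _) (trans (cong (a *_) (mono-diag (suc s))) (ℤP.*-identityʳ a)))
  ... | no  n≢s  = sym (trans (ℤP.+-identityˡ _) (trans (cong (a *_) (mono-off n≢s)) (ℤP.*-zeroʳ a)))

·-onePlus : ∀ f a s → f · onePlus a s ≈ f ⊕ a ⋆ shift (suc s) f
·-onePlus f a s = begin
  f · onePlus a s                        ≈⟨ ·-congʳ f (onePlus-≈ a s) ⟩
  f · (oneS ⊕ a ⋆ mono (suc s))          ≈⟨ ·-distribˡ-⊕ f oneS (a ⋆ mono (suc s)) ⟩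
  f · oneS ⊕ f · (a ⋆ mono (suc s))      ≈⟨ ⊕-cong (·-identityʳ f) (·-⋆ f a (mono (suc s))) ⟩
  f ⊕ a ⋆ (f · mono (suc s))             ≈⟨ ⊕-cong (≈-refl {f}) (⋆-cong a (·-mono f (suc s))) ⟩
  f ⊕ a ⋆ shift (suc s) f                ∎
  where open ≈-Reasoning

geom-< : ∀ a s {n} → 0 < n → n < suc s → geom a s n ≡ 0ℤ
geom-< a s {n} 0<n n<s+1 with n % suc s ℕ.≟ 0
... | no  _       = refl
... | yes n%s+1≡0 = ⊥-elim (ℕP.<⇒≢ 0<n (sym (trans (sym (m<n⇒m%n≡m n<s+1)) n%s+1≡0)))

geom-≥ : ∀ a s {n} → suc s ≤ n → geom a s n ≡ a * geom a s (n ∸ suc s)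
geom-≥ a s {n} s+1≤n with n % suc s ℕ.≟ 0 | (n ∸ suc s) % suc s ℕ.≟ 0
... | yes _  | yes _  = cong (a ℤ.^_) (m/n≡1+[m∸n]/n s+1≤n)
... | yes ≡0 | no ≢0  = ⊥-elim (≢0 (trans (sym same-rem) ≡0))
  where same-rem = trans (cong (_% suc s) (sym (ℕP.m∸n+n≡m s+1≤n))) ([m+n]%n≡m%n (n ∸ suc s) (suc s))
... | no ≢0  | yes ≡0 = ⊥-elim (≢0 (trans same-rem ≡0))
  where same-rem = trans (cong (_% suc s) (sym (ℕP.m∸n+n≡m s+1≤n))) ([m+n]%n≡m%n (n ∸ suc s) (suc s))
... | no _   | no _   = sym (ℤP.*-zeroʳ a)

geom-≈ : ∀ a s → geom a s ≈ oneS ⊕ a ⋆ shift (suc s) (geom a s)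
geom-≈ a s = coeffwise go
  where
  go : ∀ n → geom a s n ≡ oneS n + a * shift (suc s) (geom a s) n
  go zero = sym (trans (cong (λ x → 1ℤ + a * x) (shift-< {suc s} (geom a s) (s≤s z≤n)))
                       (cong (_+_ 1ℤ) (ℤP.*-zeroʳ a)))
  go (suc n) with suc s ≤? suc n
  ... | yes s+1≤n+1 = trans (geom-≥ a s s+1≤n+1) (sym (ℤP.+-identityˡ _))
  ... | no  s+1≰n+1 = trans (geom-< a s (s≤s z≤n) (ℕP.≰⇒> s+1≰n+1))
                            (sym (trans (ℤP.+-identityˡ _) (ℤP.*-zeroʳ a)))

·-geom : ∀ f a s → f · geom a s ≈ f ⊕ a ⋆ shift (suc s) (f · geom a s)
·-geom f a s = begin
  f · geom a s                      ≈⟨ ·-congʳ f (geom-≈ a s) ⟩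
  f · (oneS ⊕ a ⋆ g)                ≈⟨ ·-distribˡ-⊕ f oneS (a ⋆ g) ⟩
  f · oneS ⊕ f · (a ⋆ g)            ≈⟨ ⊕-cong (·-identityʳ f) (·-⋆ f a g) ⟩
  f ⊕ a ⋆ (f · g)                   ≈⟨ ⊕-cong (≈-refl {f}) (⋆-cong a (·-shift (suc s) f (geom a s))) ⟩
  f ⊕ a ⋆ shift (suc s) (f · geom a s) ∎
  where
  open ≈-Reasoning
  g : PS
  g = shift (suc s) (geom a s)

geom-·-onePlus : ∀ a s → geom a s · onePlus (- a) s ≈ oneS
geom-·-onePlus a s = coeffwise λ n → begin
  (geom a s · onePlus (- a) s) n                        ≡⟨ coeff (·-onePlus (geom a s) (- a) s) n ⟩
  geom a s n + - a * x n                                ≡⟨ cong (_+ - a * x n) (coeff (geom-≈ a s) n) ⟩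
  oneS n + a * x n + - a * x n                          ≡⟨ cancel (oneS n) a (x n) ⟩
  oneS n                                                ∎
  where
  open ≡-Reasoning
  x : PS
  x = shift (suc s) (geom a s)
  cancel : ∀ o a x → o + a * x + - a * x ≡ o
  cancel = solve-∀

prodTo-· : ∀ F G m → prodTo F m · prodTo G m ≈ prodTo (λ k → F k · G k) m
prodTo-· F G zero    = ·-identityˡ oneS
prodTo-· F G (suc m) = ≈-trans (interchange (prodTo F m) (F m) (prodTo G m) (G m)) (·-congˡ (F m · G m) (prodTo-· F G m))
  where
  open ·-Solver using (solve; _⊜_) renaming (_⊕_ to _⊛_; id to ε)
  interchange : ∀ a b c d → (a · b) · (c · d) ≈ (a · c) · (b · d)
  interchange = solve 4 (λ a b c d → (a ⊛ b) ⊛ (c ⊛ d) ⊜ (a ⊛ c) ⊛ (b ⊛ d)) ≈-refl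

prodTo-oneS : ∀ F m → (∀ k → F k ≈ oneS) → prodTo F m ≈ oneS
prodTo-oneS F zero    F≈1 = ≈-refl
prodTo-oneS F (suc m) F≈1 = ≈-trans (·-cong (prodTo-oneS F m F≈1) (F≈1 m)) (·-identityˡ oneS)

negqPoch-·-invNegqPoch : ∀ m → negqPoch m · invNegqPoch m ≈ oneS
negqPoch-·-invNegqPoch m = ≈-trans (prodTo-· _ _ m)
  (prodTo-oneS _ m λ k → ≈-trans (·-comm (onePlus 1ℤ k) (geom -1ℤ k)) (geom-·-onePlus -1ℤ k))

prodTo-stable : ∀ F → (∀ k → F k ≈[ k ] oneS) → ∀ {N} M → N ≤ M → prodTo F M ≈[ N ] prodTo F N
prodTo-stable F F≈1 zero    z≤n   = ≈[]-refl
prodTo-stable F F≈1 (suc M) N≤M+1 with ℕP.m≤n⇒m<n∨m≡n N≤M+1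
... | inj₂ refl     = ≈[]-refl
... | inj₁ (s≤s N≤M) = ≈[]-trans (·-cong-≈[] (≈[]-refl {prodTo F M}) (≈[]-weaken N≤M (F≈1 M)))
                         (≈[]-trans (≈⇒≈[] _ (·-identityʳ (prodTo F M))) (prodTo-stable F F≈1 M N≤M))

prodInf-≈[] : ∀ F → (∀ k → F k ≈[ k ] oneS) → ∀ N → prodInf F ≈[ N ] prodTo F N
prodInf-≈[] F F≈1 N = coeffwise≤ λ {j} j≤N → sym (coeff≤ (prodTo-stable F F≈1 N j≤N) ℕP.≤-refl)

onePlus-≈[] : ∀ a k → onePlus a k ≈[ k ] oneS
onePlus-≈[] a k = coeffwise≤ go
  where
  go : ∀ {j} → j ≤ k → onePlus a k j ≡ oneS j
  go {zero}  _   = refl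
  go {suc j} j<k with suc j ℕ.≟ suc k
  ... | yes refl = ⊥-elim (ℕP.<-irrefl refl j<k)
  ... | no  _    = refl

geom-≈[] : ∀ a k → geom a k ≈[ k ] oneS
geom-≈[] a k = coeffwise≤ go
  where
  go : ∀ {j} → j ≤ k → geom a k j ≡ oneS j
  go {zero}  _   = refl
  go {suc j} j<k = geom-< a k (s≤s z≤n) (s≤s j<k)

invqPoch : ℕ → PS
invqPoch = prodTo (geom 1ℤ)

Pbar-≈[] : ∀ n → Pbar ≈[ n ] negqPoch n · invqPoch n
Pbar-≈[] n = ·-cong-≈[] (prodInf-≈[] _ (onePlus-≈[] 1ℤ) n) (prodInf-≈[] _ (geom-≈[] 1ℤ) n)

-- Counting

Counted : {A : Set} → (A → Set) → ℤ → Set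
Counted P z = Σ ℕ λ c → HasCardinality P c × (z ≡ + c)

module _ {A : Set} where

  counted-⇔ : ∀ {P Q : A → Set} {z} → (∀ x → P x → Q x) → (∀ x → Q x → P x) → Counted P z → Counted Q z
  counted-⇔ P⇒Q Q⇒P (c , (f , f-inj , f∈P , f-onto) , z≡c) =
    c , (f , f-inj , (λ i → P⇒Q (f i) (f∈P i)) , (λ x Qx → f-onto x (Q⇒P x Qx))) , z≡c

  counted-≡ : ∀ {P : A → Set} {z z′} → z ≡ z′ → Counted P z → Counted P z′
  counted-≡ z≡z′ (c , card , z≡c) = c , card , trans (sym z≡z′) z≡c

  counted-none : ∀ {P : A → Set} → (∀ x → ¬ P x) → Counted P 0ℤ
  counted-none ¬P = 0 , ((λ ()) , (λ { {()} }) , (λ ()) , (λ x Px → ⊥-elim (¬P x Px))) , refl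

  counted-single : ∀ (x : A) → Counted (_≡ x) 1ℤ
  counted-single x =
    1 , ((λ _ → x) , (λ { {Fin.zero} {Fin.zero} _ → refl }) , (λ _ → refl) , (λ y y≡x → Fin.zero , sym y≡x)) , refl

  counted-⊎ : ∀ {P Q : A → Set} {a b} → Counted P a → Counted Q b → (∀ x → P x → ¬ Q x) →
              Counted (λ x → P x ⊎ Q x) (a + b)
  counted-⊎ {P} {Q} (c , (f , f-inj , f∈P , f-onto) , a≡c) (d , (g , g-inj , g∈Q , g-onto) , b≡d) disjoint =
    c ℕ.+ d , (h ∘ Fin.splitAt c , h-inj , h∈ ∘ Fin.splitAt c , h-onto) , cong₂ _+_ a≡c b≡d
    where
    h : Fin c ⊎ Fin d → A
    h (inj₁ i) = f i
    h (inj₂ j) = g j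
    h∈ : ∀ s → P (h s) ⊎ Q (h s)
    h∈ (inj₁ i) = inj₁ (f∈P i)
    h∈ (inj₂ j) = inj₂ (g∈Q j)
    h-inj′ : ∀ s t → h s ≡ h t → s ≡ t
    h-inj′ (inj₁ i) (inj₁ j) e = cong inj₁ (f-inj e)
    h-inj′ (inj₂ i) (inj₂ j) e = cong inj₂ (g-inj e)
    h-inj′ (inj₁ i) (inj₂ j) e = ⊥-elim (disjoint (g j) (subst P e (f∈P i)) (g∈Q j))
    h-inj′ (inj₂ i) (inj₁ j) e = ⊥-elim (disjoint (f j) (f∈P j) (subst Q e (g∈Q i)))
    h-inj : ∀ {i j} → h (Fin.splitAt c i) ≡ h (Fin.splitAt c j) → i ≡ j
    h-inj {i} {j} e = trans (sym (FinP.join-splitAt c d i))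
                        (trans (cong (Fin.join c d) (h-inj′ (Fin.splitAt c i) (Fin.splitAt c j) e)) (FinP.join-splitAt c d j))
    h-onto : ∀ x → P x ⊎ Q x → ∃ λ i → h (Fin.splitAt c i) ≡ x
    h-onto x (inj₁ Px) with f-onto x Px
    ... | i , fi≡x = i Fin.↑ˡ d , trans (cong h (FinP.splitAt-↑ˡ c i d)) fi≡x
    h-onto x (inj₂ Qx) with g-onto x Qx
    ... | j , gj≡x = c Fin.↑ʳ j , trans (cong h (FinP.splitAt-↑ʳ c d j)) gj≡x

  counted-× : ∀ {Q : Set} {P : A → Set} {z} → Q → Counted P z → Counted (λ x → Q × P x) z
  counted-× q = counted-⇔ (λ _ Px → q , Px) (λ _ → proj₂)

  counted-×-¬ : ∀ {Q : Set} {P : A → Set} → ¬ Q → Counted (λ x → Q × P x) 0ℤ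
  counted-×-¬ ¬q = counted-none (λ _ → ¬q ∘ proj₁)

  HeadedBy : A → (List A → Set) → List A → Set
  HeadedBy p P []      = ⊥
  HeadedBy p P (h ∷ t) = h ≡ p × P t

  counted-HeadedBy : ∀ p {P : List A → Set} {z} → Counted P z → Counted (HeadedBy p P) z
  counted-HeadedBy p (c , (f , f-inj , f∈P , f-onto) , z≡c) =
    c , ((λ i → p ∷ f i) , f-inj ∘ ListP.∷-injectiveʳ , (λ i → refl , f∈P i) , onto) , z≡c
    where
    onto : ∀ l → HeadedBy p _ l → ∃ λ i → p ∷ f i ≡ l
    onto (h ∷ t) (refl , Pt) with f-onto t Pt
    ... | i , fi≡t = i , cong (h ∷_) fi≡t

  counted-⋃ : ∀ (P : ℕ → A → Set) (z : ℕ → ℤ) K → (∀ {m} → m < K → Counted (P m) (z m)) →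
              (∀ {m m′ x} → m < K → m′ < K → P m x → P m′ x → m ≡ m′) →
              Counted (λ x → ∃ λ m → m < K × P m x) (sumBelow z K)
  counted-⋃ P z zero    _     _      = counted-none λ { _ (_ , () , _) }
  counted-⋃ P z (suc K) count unique =
    counted-⇔ merge split
      (counted-⊎ (counted-⋃ P z K (count ∘ ℕP.m<n⇒m<1+n) unique′) (count ℕP.≤-refl) disjoint)
    where
    merge : ∀ x → (∃ λ m → m < K × P m x) ⊎ P K x → ∃ λ m → m < suc K × P m x
    merge x (inj₁ (m , m<K , Pm)) = m , ℕP.m<n⇒m<1+n m<K , Pm
    merge x (inj₂ PK)             = K , ℕP.≤-refl , PK
    split : ∀ x → (∃ λ m → m < suc K × P m x) → (∃ λ m → m < K × P m x) ⊎ P K x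
    split x (m , m<K+1 , Pm) with ℕP.m<1+n⇒m<n∨m≡n m<K+1
    ... | inj₁ m<K  = inj₁ (m , m<K , Pm)
    ... | inj₂ refl = inj₂ Pm
    unique′ : ∀ {m m′ x} → m < K → m′ < K → P m x → P m′ x → m ≡ m′
    unique′ m<K m′<K = unique (ℕP.m<n⇒m<1+n m<K) (ℕP.m<n⇒m<1+n m′<K)
    disjoint : ∀ x → (∃ λ m → m < K × P m x) → ¬ P K x
    disjoint x (m , m<K , Pm) PK = ℕP.<⇒≢ m<K (unique (ℕP.m<n⇒m<1+n m<K) ℕP.≤-refl Pm PK)

-- The order on parts

infix 4 _≼_ _⋖_

_≼_ : Part → Part → Set
p ≼ q = p ≺ q ⊎ p ≡ q

_⋖_ : Part → Part → Set
p ⋖ q = p ≺ q × (∀ {r} → r ≺ q → r ≼ p)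

≺-irrefl : ∀ {p} → ¬ p ≺ p
≺-irrefl (inj₁ k<k)           = ℕP.<-irrefl refl k<k
≺-irrefl (inj₂ (_ , refl , ()))

≺-trans : ∀ {p q r} → p ≺ q → q ≺ r → p ≺ r
≺-trans (inj₁ i<j)          (inj₁ j<k)              = inj₁ (ℕP.<-trans i<j j<k)
≺-trans (inj₁ i<j)          (inj₂ (refl , _ , _))   = inj₁ i<j
≺-trans (inj₂ (refl , _ , _)) (inj₁ j<k)            = inj₁ j<k
≺-trans (inj₂ (refl , _ , refl)) (inj₂ (refl , () , _))

≺-asym : ∀ {p q} → p ≺ q → ¬ q ≺ p
≺-asym p≺q q≺p = ≺-irrefl (≺-trans p≺q q≺p)

≼-≺-trans : ∀ {p q r} → p ≼ q → q ≺ r → p ≺ r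
≼-≺-trans (inj₁ p≺q) q≺r = ≺-trans p≺q q≺r
≼-≺-trans (inj₂ refl) q≺r = q≺r

≺-≼-trans : ∀ {p q r} → p ≺ q → q ≼ r → p ≺ r
≺-≼-trans p≺q (inj₁ q≺r) = ≺-trans p≺q q≺r
≺-≼-trans p≺q (inj₂ refl) = p≺q

≼-trans : ∀ {p q r} → p ≼ q → q ≼ r → p ≼ r
≼-trans p≼q (inj₁ q≺r) = inj₁ (≼-≺-trans p≼q q≺r)
≼-trans p≼q (inj₂ refl) = p≼q

≼-antisym : ∀ {p q} → p ≼ q → q ≼ p → p ≡ q
≼-antisym (inj₂ p≡q) _           = p≡q
≼-antisym (inj₁ _)   (inj₂ q≡p)  = sym q≡p
≼-antisym (inj₁ p≺q) (inj₁ q≺p)  = ⊥-elim (≺-asym p≺q q≺p)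

≼-size : ∀ {p q} → p ≼ q → proj₁ p ≤ proj₁ q
≼-size (inj₁ (inj₁ j<k))             = ℕP.<⇒≤ j<k
≼-size (inj₁ (inj₂ (refl , _ , _)))  = ℕP.≤-refl
≼-size (inj₂ refl)                   = ℕP.≤-refl

≺-tri : Trichotomous _≡_ _≺_
≺-tri (j , b) (k , c) with ℕP.<-cmp j k
... | tri< j<k _ _ = tri< (inj₁ j<k) (λ e → ℕP.<⇒≢ j<k (cong proj₁ e)) (≺-asym (inj₁ j<k))
... | tri> _ _ k<j = tri> (≺-asym (inj₁ k<j)) (λ e → ℕP.<⇒≢ k<j (sym (cong proj₁ e))) (inj₁ k<j)
... | tri≈ _ refl _ with b | c
...   | false | false = tri≈ ≺-irrefl refl ≺-irrefl
...   | false | true  = tri< (inj₂ (refl , refl , refl)) (λ ()) (≺-asym (inj₂ (refl , refl , refl)))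
...   | true  | false = tri> (≺-asym (inj₂ (refl , refl , refl))) (λ ()) (inj₂ (refl , refl , refl))
...   | true  | true  = tri≈ ≺-irrefl refl ≺-irrefl

plain⋖bar : ∀ {s} → (s , false) ⋖ (s , true)
plain⋖bar = inj₂ (refl , refl , refl) , cover
  where
  cover : ∀ {s r} → r ≺ (s , true) → r ≼ (s , false)
  cover (inj₁ j<s)                    = inj₁ (inj₁ j<s)
  cover (inj₂ (refl , refl , _))      = inj₂ refl

bar⋖plain : ∀ {s} → (s , true) ⋖ (suc s , false)
bar⋖plain = inj₁ ℕP.≤-refl , cover
  where
  cover : ∀ {s r} → r ≺ (suc s , false) → r ≼ (s , true)
  cover {r = j , b} (inj₁ j<s+1) with ℕP.m<1+n⇒m<n∨m≡n j<s+1
  ... | inj₁ j<s  = inj₁ (inj₁ j<s)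
  cover {r = _ , false} (inj₁ _) | inj₂ refl = inj₁ (inj₂ (refl , refl , refl))
  cover {r = _ , true}  (inj₁ _) | inj₂ refl = inj₂ refl
  cover (inj₂ (_ , _ , ()))

plain≼ : ∀ {s b} → (s , false) ≼ (s , b)
plain≼ {b = false} = inj₂ refl
plain≼ {b = true}  = inj₁ (proj₁ plain⋖bar)

NextPart⇒≼plain : ∀ {s b r} → NextPart (s , b) r → r ≼ (s , false)
NextPart⇒≼plain {b = false} (inj₁ r≺s)          = inj₁ r≺s
NextPart⇒≼plain {b = true}  (inj₁ r≺s)          = proj₂ plain⋖bar r≺s
NextPart⇒≼plain             (inj₂ (refl , refl)) = inj₂ refl

≼plain⇒NextPart : ∀ {s b r} → r ≼ (s , false) → NextPart (s , b) r
≼plain⇒NextPart {b = false} (inj₁ r≺s)  = inj₁ r≺s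
≼plain⇒NextPart {b = true}  (inj₁ r≺s)  = inj₁ (≺-trans r≺s (proj₁ plain⋖bar))
≼plain⇒NextPart {b = false} (inj₂ refl) = inj₂ (refl , refl)
≼plain⇒NextPart {b = true}  (inj₂ refl) = inj₁ (proj₁ plain⋖bar)

Linked⇒≼head : ∀ {h t} → Linked NextPart (h ∷ t) → All (_≼ h) (h ∷ t)
Linked⇒≼head linked =
  LinkedP.Linked⇒All (λ q≼p r≼q → ≼-trans r≼q q≼p) (inj₂ refl) (Linked.map next⇒≽ linked)
  where
  next⇒≽ : ∀ {p q} → NextPart p q → q ≼ p
  next⇒≽ (inj₁ q≺p)          = inj₁ q≺p
  next⇒≽ (inj₂ (refl , _))   = inj₂ refl

Linked⇒tail≼plain : ∀ {s b t} → Linked NextPart ((s , b) ∷ t) → All (_≼ (s , false)) t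
Linked⇒tail≼plain [-]              = []
Linked⇒tail≼plain (next ∷ linked)  =
  All.map (λ x≼y → ≼-trans x≼y (NextPart⇒≼plain next)) (Linked⇒≼head linked)

∈⇒size≤sum : ∀ {p : Part} {l} → p ∈ l → proj₁ p ≤ sum (map proj₁ l)
∈⇒size≤sum {l = h ∷ t} (here refl) = ℕP.m≤m+n (proj₁ h) _
∈⇒size≤sum {l = h ∷ t} (there p∈t) = ℕP.≤-trans (∈⇒size≤sum p∈t) (ℕP.m≤n+m _ (proj₁ h))

size≤⇒≼bar : ∀ {p n} → proj₁ p ≤ n → p ≼ (n , true)
size≤⇒≼bar {j , b} j≤n with ℕP.m≤n⇒m<n∨m≡n j≤n
... | inj₁ j<n = inj₁ (inj₁ j<n)
size≤⇒≼bar {_ , false} _ | inj₂ refl = inj₁ (inj₂ (refl , refl , refl))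
size≤⇒≼bar {_ , true}  _ | inj₂ refl = inj₂ refl

-- Admissible overpartitions

data Status : Set where
  forbidden optional required : Status

Obeys : Status → Set → Set
Obeys forbidden P = ¬ P
Obeys optional  P = ⊤
Obeys required  P = P

Obeys-⇔ : ∀ st {P Q : Set} → (P → Q) → (Q → P) → Obeys st P → Obeys st Q
Obeys-⇔ forbidden _   Q→P ¬P = ¬P ∘ Q→P
Obeys-⇔ optional  _   _   _  = tt
Obeys-⇔ required  P→Q _   p  = P→Q p

Obeys-absent : ∀ {P : Set} st → st ≢ required → ¬ P → Obeys st P
Obeys-absent forbidden _   ¬P = ¬P
Obeys-absent optional  _   _  = tt
Obeys-absent required  st≢ _  = ⊥-elim (st≢ refl)

Obeys-present : ∀ {P : Set} st → st ≢ forbidden → P → Obeys st P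
Obeys-present forbidden st≢ _ = ⊥-elim (st≢ refl)
Obeys-present optional  _   _ = tt
Obeys-present required  _   p = p

∈-∷⁻ : ∀ {p q : Part} {t} → p ≢ q → p ∈ q ∷ t → p ∈ t
∈-∷⁻ p≢q (here p≡q) = ⊥-elim (p≢q p≡q)
∈-∷⁻ p≢q (there p∈t) = p∈t

Obeys-∷⁻ : ∀ st {p q : Part} {t} → p ≢ q → Obeys st (p ∈ q ∷ t) → Obeys st (p ∈ t)
Obeys-∷⁻ st p≢q = Obeys-⇔ st (∈-∷⁻ p≢q) there

Obeys-∷⁺ : ∀ st {p q : Part} {t} → p ≢ q → Obeys st (p ∈ t) → Obeys st (p ∈ q ∷ t)
Obeys-∷⁺ st p≢q = Obeys-⇔ st there (∈-∷⁻ p≢q)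

Profile : Set
Profile = Part → Status

-- The top part B carries its own status, since a non-overlined B becomes optional once one
-- copy of it has been removed (see tailTop). Statuses only constrain parts of positive size,
-- so that the recursion can bottom out at the bound (0 , true).
record Admissible (π : Profile) (B : Part) (top : Status) (N : ℕ) (l : List Part) : Set where
  field
    overpartition : IsOverpartition N l
    bounded       : All (_≼ B) l
    obeys-below   : ∀ {p} → p ≺ B → 1 ≤ proj₁ p → Obeys (π p) (p ∈ l)
    obeys-top     : 1 ≤ proj₁ B → Obeys top (B ∈ l)
open Admissible

Admissible⇒∉ : ∀ {π P B st N l} → Admissible π P st N l → P ≺ B → B ∉ l
Admissible⇒∉ adm P≺B B∈l = ≺-irrefl (≼-≺-trans (All.lookup (bounded adm) B∈l) P≺B)

∉-head≢ : ∀ {π B top N h t} → Admissible π B top N (h ∷ t) → h ≢ B → B ∉ h ∷ t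
∉-head≢ adm h≢B B∈l = h≢B (≼-antisym (All.head (bounded adm)) (All.lookup (Linked⇒≼head linked) B∈l))
  where linked = proj₁ (proj₂ (overpartition adm))

module _ {π : Profile} {P B : Part} (P⋖B : P ⋖ B) where

  Admissible-lower : ∀ {top N l} → 1 ≤ proj₁ B → Admissible π B top N l → B ∉ l →
                     top ≢ required × Admissible π P (π P) N l
  Admissible-lower {top} {l = l} 1≤B adm B∉l =
    (λ { refl → B∉l (obeys-top adm 1≤B) }) ,
    record { overpartition = overpartition adm
           ; bounded       = All.tabulate λ x∈l → lower x∈l (All.lookup (bounded adm) x∈l)
           ; obeys-below   = λ p≺P → obeys-below adm (≺-trans p≺P (proj₁ P⋖B))
           ; obeys-top     = obeys-below adm (proj₁ P⋖B) }
    where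
    lower : ∀ {x} → x ∈ l → x ≼ B → x ≼ P
    lower _   (inj₁ x≺B)  = proj₂ P⋖B x≺B
    lower x∈l (inj₂ refl) = ⊥-elim (B∉l x∈l)

  Admissible-raise : ∀ {top N l} → top ≢ required → Admissible π P (π P) N l → Admissible π B top N l
  Admissible-raise {top} top≢required adm = record
    { overpartition = overpartition adm
    ; bounded       = All.map (λ x≼P → inj₁ (≼-≺-trans x≼P (proj₁ P⋖B))) (bounded adm)
    ; obeys-below   = below
    ; obeys-top     = λ _ → Obeys-absent top top≢required (Admissible⇒∉ adm (proj₁ P⋖B)) }
    where
    below : ∀ {p} → p ≺ B → 1 ≤ proj₁ p → Obeys (π p) (p ∈ _)
    below p≺B 1≤p with proj₂ P⋖B p≺B
    ... | inj₁ p≺P  = obeys-below adm p≺P 1≤p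
    ... | inj₂ refl = obeys-top adm 1≤p

-- The status of (s , false) among the remaining parts once the largest part (s , b) is removed.
tailTop : Profile → Part → Status
tailTop π (s , false) = optional
tailTop π (s , true)  = π (s , false)

module _ {π : Profile} {S : ℕ} {b : Bool} where

  Admissible-∷⁻ : ∀ {top N t} → Admissible π (S , b) top N ((S , b) ∷ t) →
                  top ≢ forbidden × S ≤ N × Admissible π (S , false) (tailTop π (S , b)) (N ∸ S) t
  Admissible-∷⁻ {top} {N} {t} adm with overpartition adm
  ... | positive , linked , sum≡N =
    (λ { refl → obeys-top adm 1≤S (here refl) }) ,
    subst (S ≤_) sum≡N (ℕP.m≤m+n S _) ,
    record { overpartition = All.tail positive , Linked.tail linked ,
                             trans (sym (ℕP.m+n∸m≡n S _)) (cong (_∸ S) sum≡N)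
           ; bounded       = Linked⇒tail≼plain linked
           ; obeys-below   = λ {p} p≺S 1≤p →
               Obeys-∷⁻ (π p) (λ { refl → ≺-irrefl (≺-≼-trans p≺S plain≼) })
                        (obeys-below adm (≺-≼-trans p≺S plain≼) 1≤p)
           ; obeys-top     = top-of-tail adm }
    where
    1≤S : 1 ≤ S
    1≤S = All.head positive
    top-of-tail : ∀ {b} → Admissible π (S , b) top N ((S , b) ∷ t) → 1 ≤ S →
                  Obeys (tailTop π (S , b)) ((S , false) ∈ t)
    top-of-tail {false} _   _   = tt
    top-of-tail {true}  adm 1≤S = Obeys-∷⁻ (π (S , false)) (λ ()) (obeys-below adm (proj₁ plain⋖bar) 1≤S)

  Admissible-∷⁺ : ∀ {top N t} → 1 ≤ S → top ≢ forbidden → S ≤ N →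
                  Admissible π (S , false) (tailTop π (S , b)) (N ∸ S) t → Admissible π (S , b) top N ((S , b) ∷ t)
  Admissible-∷⁺ {top} {N} {t} 1≤S top≢forbidden S≤N adm with overpartition adm
  ... | positive , linked , sum≡N∸S = record
    { overpartition = 1≤S ∷ positive , link (bounded adm) linked ,
                      trans (cong (S ℕ.+_) sum≡N∸S) (ℕP.m+[n∸m]≡n S≤N)
    ; bounded       = inj₂ refl ∷ All.map (λ x≼ → ≼-trans x≼ plain≼) (bounded adm)
    ; obeys-below   = below adm
    ; obeys-top     = λ _ → Obeys-present top top≢forbidden (here refl) }
    where
    link : ∀ {t} → All (_≼ (S , false)) t → Linked NextPart t → Linked NextPart ((S , b) ∷ t)
    link []            _      = [-]
    link (y≼S ∷ _)     linked = ≼plain⇒NextPart y≼S ∷ linked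
    below : ∀ {b p} → Admissible π (S , false) (tailTop π (S , b)) (N ∸ S) t → p ≺ (S , b) → 1 ≤ proj₁ p →
            Obeys (π p) (p ∈ (S , b) ∷ t)
    below {false} adm p≺S 1≤p = Obeys-∷⁺ (π _) (λ { refl → ≺-irrefl p≺S }) (obeys-below adm p≺S 1≤p)
    below {true}  adm p≺S 1≤p with proj₂ plain⋖bar p≺S
    ... | inj₁ p≺plain = Obeys-∷⁺ (π _) (λ { refl → ≺-irrefl p≺S }) (obeys-below adm p≺plain 1≤p)
    ... | inj₂ refl    = Obeys-∷⁺ (π _) (λ ()) (obeys-top adm 1≤p)

Admissible-bottom⇒[] : ∀ {π b top N l} → Admissible π (0 , b) top N l → l ≡ []
Admissible-bottom⇒[] {l = []}    _   = refl
Admissible-bottom⇒[] {l = _ ∷ _} adm =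
  ⊥-elim (ℕP.<⇒≱ (All.head (proj₁ (overpartition adm))) (≼-size (All.head (bounded adm))))

counted-bottom : ∀ π b top N → Counted (Admissible π (0 , b) top N) (oneS N)
counted-bottom π b top zero    =
  counted-⇔ (λ { _ refl → empty-admissible }) (λ _ → Admissible-bottom⇒[]) (counted-single [])
  where
  empty-admissible : Admissible π (0 , b) top 0 []
  empty-admissible = record
    { overpartition = [] , [] , refl
    ; bounded       = []
    ; obeys-below   = λ p≺0 1≤p → ⊥-elim (ℕP.<⇒≱ 1≤p (≼-size (inj₁ p≺0)))
    ; obeys-top     = λ () }
counted-bottom π b top (suc N) = counted-none λ _ adm → nonempty adm (Admissible-bottom⇒[] adm)
  where
  nonempty : ∀ {l} → Admissible π (0 , b) top (suc N) l → l ≢ []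
  nonempty adm refl with overpartition adm
  ... | _ , _ , ()

avoid : Status → PS → PS
avoid forbidden f = f
avoid optional  f = f
avoid required  _ = zeroS

include : Status → PS → PS
include forbidden _ = zeroS
include optional  f = f
include required  f = f

plainFactor : Status → ℕ → PS
plainFactor forbidden s = oneS
plainFactor optional  s = geom 1ℤ s
plainFactor required  s = mono (suc s) · geom 1ℤ s

barFactor : Status → ℕ → PS
barFactor forbidden s = oneS
barFactor optional  s = onePlus 1ℤ s
barFactor required  s = mono (suc s)

·-plainFactor : ∀ f top s → f · plainFactor top s ≈ avoid top f ⊕ include top (shift (suc s) (f · geom 1ℤ s))
·-plainFactor f forbidden s = ≈-trans (·-identityʳ f) (≈-sym (⊕-identityʳ f))
·-plainFactor f optional  s = ≈-trans (·-geom f 1ℤ s) (⊕-cong (≈-refl {f}) (⋆-identityˡ _))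
·-plainFactor f required  s = begin
  f · (mono (suc s) · geom 1ℤ s)     ≈⟨ swap f (mono (suc s)) (geom 1ℤ s) ⟩
  mono (suc s) · (f · geom 1ℤ s)     ≈⟨ mono-· (suc s) (f · geom 1ℤ s) ⟩
  shift (suc s) (f · geom 1ℤ s)      ≈⟨ ⊕-identityˡ _ ⟨
  zeroS ⊕ shift (suc s) (f · geom 1ℤ s) ∎
  where
  open ≈-Reasoning
  open ·-Solver using (solve; _⊜_) renaming (_⊕_ to _⊛_; id to ε)
  swap : ∀ a b c → a · (b · c) ≈ b · (a · c)
  swap = solve 3 (λ a b c → a ⊛ (b ⊛ c) ⊜ b ⊛ (a ⊛ c)) ≈-refl

·-barFactor : ∀ f top s → f · barFactor top s ≈ avoid top f ⊕ include top (shift (suc s) f)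
·-barFactor f forbidden s = ≈-trans (·-identityʳ f) (≈-sym (⊕-identityʳ f))
·-barFactor f optional  s = ≈-trans (·-onePlus f 1ℤ s) (⊕-cong (≈-refl {f}) (⋆-identityˡ _))
·-barFactor f required  s =
  ≈-trans (·-mono f (suc s)) (≈-sym (⊕-identityˡ _))

counted-avoid : ∀ {Q : List Part → Set} top {f : PS} {N} →
                Counted Q (f N) → Counted (λ l → top ≢ required × Q l) (avoid top f N)
counted-avoid forbidden = counted-× (λ ())
counted-avoid optional  = counted-× (λ ())
counted-avoid required  _ = counted-×-¬ (λ top≢required → top≢required refl)

counted-include : ∀ {Q : List Part → Set} top {f : PS} {N} →
                  Counted Q (f N) → Counted (λ l → top ≢ forbidden × Q l) (include top f N)
counted-include forbidden _ = counted-×-¬ (λ top≢forbidden → top≢forbidden refl)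
counted-include optional    = counted-× (λ ())
counted-include required    = counted-× (λ ())

counted-shift : ∀ {Q : List Part → Set} S {f : PS} {N} →
                (S ≤ N → Counted Q (f (N ∸ S))) → Counted (λ l → S ≤ N × Q l) (shift S f N)
counted-shift S {f} {N} count with ℕP.≤-<-connex S N
... | inj₁ S≤N = counted-≡ (sym (shift-≥ f S≤N)) (counted-× S≤N (count S≤N))
... | inj₂ N<S = counted-≡ (sym (shift-< f N<S)) (counted-×-¬ (ℕP.<⇒≱ N<S))

-- Either the top part is absent, or it is the largest part of the list.
counted-Admissible-top : ∀ {π P s b top N} {y x : PS} → P ⋖ (suc s , b) →
  Counted (Admissible π P (π P) N) (y N) →
  (suc s ≤ N → Counted (Admissible π (suc s , false) (tailTop π (suc s , b)) (N ∸ suc s)) (x (N ∸ suc s))) →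
  Counted (Admissible π (suc s , b) top N) (avoid top y N + include top (shift (suc s) x) N)
counted-Admissible-top {π} {P} {s} {b} {top} {N} P⋖B count-y count-x =
  counted-⇔ merge split
    (counted-⊎ (counted-avoid top count-y)
               (counted-include top (counted-shift (suc s) (counted-HeadedBy (suc s , b) ∘ count-x)))
               disjoint)
  where
  Tail Without With : List Part → Set
  Tail      = Admissible π (suc s , false) (tailTop π (suc s , b)) (N ∸ suc s)
  Without l = top ≢ required × Admissible π P (π P) N l
  With    l = top ≢ forbidden × (suc s ≤ N × HeadedBy (suc s , b) Tail l)
  merge : ∀ l → Without l ⊎ With l → Admissible π (suc s , b) top N l
  merge l       (inj₁ (top≢required , adm))                    = Admissible-raise P⋖B top≢required adm
  merge (_ ∷ _) (inj₂ (top≢forbidden , S≤N , refl , adm))      = Admissible-∷⁺ (s≤s z≤n) top≢forbidden S≤N adm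
  split : ∀ l → Admissible π (suc s , b) top N l → Without l ⊎ With l
  split []      adm = inj₁ (Admissible-lower P⋖B (s≤s z≤n) adm (λ ()))
  split (h ∷ t) adm with ≡-dec ℕ._≟_ Bool._≟_ h (suc s , b)
  ... | yes refl = let top≢forbidden , S≤N , adm-t = Admissible-∷⁻ adm in inj₂ (top≢forbidden , S≤N , refl , adm-t)
  ... | no  h≢B  = inj₁ (Admissible-lower P⋖B (s≤s z≤n) adm (∉-head≢ adm h≢B))
  disjoint : ∀ l → Without l → ¬ With l
  disjoint (_ ∷ _) (_ , adm) (_ , _ , refl , _) = Admissible⇒∉ adm (proj₁ P⋖B) (here refl)

counted-Admissible-plain : ∀ π s {Y : PS} → (∀ N → Counted (Admissible π (s , true) (π (s , true)) N) (Y N)) →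
                           ∀ top N → Counted (Admissible π (suc s , false) top N) ((Y · plainFactor top s) N)
counted-Admissible-plain π s {Y} count-Y top N =
  counted-≡ (sym (coeff (·-plainFactor Y top s) N))
    (counted-Admissible-top {y = Y} {x = Y · geom 1ℤ s} bar⋖plain (count-Y N) (λ _ → count-optional (N ∸ suc s)))
  where
  count-optional : ∀ N → Counted (Admissible π (suc s , false) optional N) ((Y · geom 1ℤ s) N)
  count-optional = <-rec _ λ N rec →
    counted-≡ (sym (coeff (·-plainFactor Y optional s) N))
      (counted-Admissible-top {y = Y} {x = Y · geom 1ℤ s} bar⋖plain (count-Y N)
         (λ S≤N → rec (ℕP.∸-monoʳ-< (s≤s z≤n) S≤N)))

counted-Admissible-bar : ∀ π s {Z : PS} →
                         (∀ N → Counted (Admissible π (suc s , false) (π (suc s , false)) N) (Z N)) →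
                         ∀ top N → Counted (Admissible π (suc s , true) top N) ((Z · barFactor top s) N)
counted-Admissible-bar π s {Z} count-Z top N =
  counted-≡ (sym (coeff (·-barFactor Z top s) N))
    (counted-Admissible-top {y = Z} {x = Z} plain⋖bar (count-Z N) (λ _ → count-Z (N ∸ suc s)))

sizeFactor : Profile → ℕ → PS
sizeFactor π s = plainFactor (π (suc s , false)) s · barFactor (π (suc s , true)) s

gfUpTo : Profile → ℕ → PS
gfUpTo π = prodTo (sizeFactor π)

counted-Admissible : ∀ π s N → Counted (Admissible π (s , true) (π (s , true)) N) (gfUpTo π s N)
counted-Admissible π zero    N = counted-bottom π true (π (0 , true)) N
counted-Admissible π (suc s) N =
  counted-≡ (coeff (·-assoc (gfUpTo π s) (plainFactor (π (suc s , false)) s) (barFactor (π (suc s , true)) s)) N)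
    (counted-Admissible-bar π s (counted-Admissible-plain π s (counted-Admissible π s) (π (suc s , false)))
                            (π (suc s , true)) N)

-- Overpartitions with a given omex~

omexProfile : Part → Profile
omexProfile K p with ≺-tri p K
... | tri< _ _ _ = required
... | tri≈ _ _ _ = forbidden
... | tri> _ _ _ = optional

omexProfile-≺ : ∀ {K p} → p ≺ K → omexProfile K p ≡ required
omexProfile-≺ {K} {p} p≺K with ≺-tri p K
... | tri< _ _ _     = refl
... | tri≈ p⊀K _ _   = ⊥-elim (p⊀K p≺K)
... | tri> p⊀K _ _   = ⊥-elim (p⊀K p≺K)

omexProfile-≡ : ∀ K → omexProfile K K ≡ forbidden
omexProfile-≡ K with ≺-tri K K
... | tri< K≺K _ _   = ⊥-elim (≺-irrefl K≺K)
... | tri≈ _ _ _     = refl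
... | tri> _ _ K≺K   = ⊥-elim (≺-irrefl K≺K)

omexProfile-≻ : ∀ {K p} → K ≺ p → omexProfile K p ≡ optional
omexProfile-≻ {K} {p} K≺p with ≺-tri p K
... | tri< _ _ K⊀p   = ⊥-elim (K⊀p K≺p)
... | tri≈ _ _ K⊀p   = ⊥-elim (K⊀p K≺p)
... | tri> _ _ _     = refl

FirstGap : Part → List Part → Set
FirstGap K l = K ∉ l × (∀ {p} → p ≺ K → 1 ≤ proj₁ p → p ∈ l)

FirstGap-unique : ∀ {K K′ l} → 1 ≤ proj₁ K → 1 ≤ proj₁ K′ → FirstGap K l → FirstGap K′ l → K ≡ K′
FirstGap-unique {K} {K′} 1≤K 1≤K′ (K∉l , below-K) (K′∉l , below-K′) with ≺-tri K K′
... | tri< K≺K′ _ _ = ⊥-elim (K∉l (below-K′ K≺K′ 1≤K))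
... | tri≈ _ K≡K′ _ = K≡K′
... | tri> _ _ K′≺K = ⊥-elim (K′∉l (below-K K′≺K 1≤K′))

Obeys-omexProfile : ∀ {K l p} → FirstGap K l → 1 ≤ proj₁ p → Obeys (omexProfile K p) (p ∈ l)
Obeys-omexProfile {K} {l} {p} (K∉l , below-K) 1≤p with ≺-tri p K
... | tri< p≺K _ _    = below-K p≺K 1≤p
... | tri≈ _ refl _   = K∉l
... | tri> _ _ _      = tt

module _ {K B : Part} {N : ℕ} {l : List Part} where

  Admissible-omex⁺ : IsOverpartition N l → All (_≼ B) l → FirstGap K l →
                     Admissible (omexProfile K) B (omexProfile K B) N l
  Admissible-omex⁺ overpartition bounded gap = record
    { overpartition = overpartition
    ; bounded       = bounded
    ; obeys-below   = λ _ → Obeys-omexProfile gap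
    ; obeys-top     = Obeys-omexProfile gap }

  Admissible-omex⁻ : K ≼ B → 1 ≤ proj₁ K → Admissible (omexProfile K) B (omexProfile K B) N l → FirstGap K l
  Admissible-omex⁻ K≼B 1≤K adm = K∉l K≼B , λ p≺K 1≤p →
    subst (λ st → Obeys st (_ ∈ l)) (omexProfile-≺ p≺K) (obeys-below adm (≺-≼-trans p≺K K≼B) 1≤p)
    where
    K∉l : K ≼ B → K ∉ l
    K∉l (inj₁ K≺B)  = subst (λ st → Obeys st (K ∈ l)) (omexProfile-≡ K) (obeys-below adm K≺B 1≤K)
    K∉l (inj₂ refl) = subst (λ st → Obeys st (K ∈ l)) (omexProfile-≡ K) (obeys-top adm 1≤K)

IsOverpartition⇒≼bar : ∀ {n l} → IsOverpartition n l → All (_≼ (n , true)) l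
IsOverpartition⇒≼bar (_ , _ , sum≡n) =
  All.tabulate λ p∈l → size≤⇒≼bar (subst (_ ≤_) sum≡n (∈⇒size≤sum p∈l))

MTildeProp⇒FirstGap : ∀ {l} → MTildeProp l → Σ ℕ λ k → 1 ≤ k × FirstGap (k , true) l
MTildeProp⇒FirstGap (k , 1≤k , k∉l , bars , plains) = k , 1≤k , k∉l , below
  where
  below : ∀ {p} → p ≺ (k , true) → 1 ≤ proj₁ p → p ∈ _
  below {j , false} (inj₁ j<k)             1≤j = plains j 1≤j (ℕP.<⇒≤ j<k)
  below {j , false} (inj₂ (refl , _ , _))  1≤j = plains j 1≤j ℕP.≤-refl
  below {j , true}  (inj₁ j<k)             1≤j = bars j 1≤j j<k

FirstGap⇒MTildeProp : ∀ {k l} → 1 ≤ k → FirstGap (k , true) l → MTildeProp l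
FirstGap⇒MTildeProp {k} 1≤k (k∉l , below) =
  k , 1≤k , k∉l , (λ j 1≤j j<k → below (inj₁ j<k) 1≤j) , (λ j 1≤j j≤k → below (plain≺ j≤k) 1≤j)
  where
  plain≺ : ∀ {j} → j ≤ k → (j , false) ≺ (k , true)
  plain≺ j≤k with ℕP.m≤n⇒m<n∨m≡n j≤k
  ... | inj₁ j<k  = inj₁ j<k
  ... | inj₂ refl = inj₂ (refl , refl , refl)

-- The overpartitions of n counted by m̃(n) whose omex~ is the overlined part m + 1.
OmexAdmissible : ℕ → ℕ → List Part → Set
OmexAdmissible n m = Admissible (omexProfile (suc m , true)) (n , true) (omexProfile (suc m , true) (n , true)) n

MTildeSet⇒OmexAdmissible : ∀ {n l} → MTildeSet n l → ∃ λ m → m < n × OmexAdmissible n m l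
MTildeSet⇒OmexAdmissible {n} (overpartition , mtilde) with MTildeProp⇒FirstGap mtilde
... | suc m , _ , gap = m , m<n , Admissible-omex⁺ overpartition (IsOverpartition⇒≼bar overpartition) gap
  where
  m<n : m < n
  m<n = ≼-size (All.lookup (IsOverpartition⇒≼bar overpartition)
                           (proj₂ gap {suc m , false} (inj₂ (refl , refl , refl)) (s≤s z≤n)))

OmexAdmissible⇒MTildeSet : ∀ {n l} → (∃ λ m → m < n × OmexAdmissible n m l) → MTildeSet n l
OmexAdmissible⇒MTildeSet (m , m<n , adm) =
  overpartition adm ,
  FirstGap⇒MTildeProp (s≤s z≤n) (Admissible-omex⁻ {K = suc m , true} (size≤⇒≼bar m<n) (s≤s z≤n) adm)

OmexAdmissible-unique : ∀ {n m m′ l} → m < n → m′ < n →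
                        OmexAdmissible n m l → OmexAdmissible n m′ l → m ≡ m′
OmexAdmissible-unique {m = m} {m′} m<n m′<n adm adm′ = ℕP.suc-injective (cong proj₁
  (FirstGap-unique (s≤s z≤n) (s≤s z≤n) (Admissible-omex⁻ {K = suc m , true} (size≤⇒≼bar m<n) (s≤s z≤n) adm)
                                       (Admissible-omex⁻ {K = suc m′ , true} (size≤⇒≼bar m′<n) (s≤s z≤n) adm′)))

-- The generating function

sizeFactor-omex-< : ∀ {k s} → suc s < k →
                    sizeFactor (omexProfile (k , true)) s ≈ (mono (suc s) · geom 1ℤ s) · mono (suc s)
sizeFactor-omex-< {k} {s} s+1<k = ≈-reflexive (cong₂ (λ a b → plainFactor a s · barFactor b s)
  (omexProfile-≺ {K = k , true} (inj₁ s+1<k)) (omexProfile-≺ {K = k , true} (inj₁ s+1<k)))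

sizeFactor-omex-≡ : ∀ s → sizeFactor (omexProfile (suc s , true)) s ≈ (mono (suc s) · geom 1ℤ s) · oneS
sizeFactor-omex-≡ s = ≈-reflexive (cong₂ (λ a b → plainFactor a s · barFactor b s)
  (omexProfile-≺ {K = suc s , true} (inj₂ (refl , refl , refl))) (omexProfile-≡ (suc s , true)))

sizeFactor-omex-> : ∀ {k s} → k < suc s → sizeFactor (omexProfile (k , true)) s ≈ geom 1ℤ s · onePlus 1ℤ s
sizeFactor-omex-> {k} {s} k<s+1 = ≈-reflexive (cong₂ (λ a b → plainFactor a s · barFactor b s)
  (omexProfile-≻ {K = k , true} (inj₁ k<s+1)) (omexProfile-≻ {K = k , true} (inj₁ k<s+1)))

module _ {k : ℕ} where

  private
    π : Profile
    π = omexProfile (k , true)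

  open ·-Solver using (solve; _⊜_) renaming (_⊕_ to _⊛_; id to ε)
  open ≈-Reasoning

  gfUpTo-omex-< : ∀ s → s < k → gfUpTo π s ≈ mono (s ℕ.* suc s) · invqPoch s
  gfUpTo-omex-< zero    _     = ≈-sym (≈-trans (·-congˡ oneS mono-zero) (·-identityˡ oneS))
  gfUpTo-omex-< (suc s) s+1<k = begin
    gfUpTo π s · sizeFactor π s
      ≈⟨ ·-cong (gfUpTo-omex-< s (ℕP.<-trans (ℕP.n<1+n s) s+1<k)) (sizeFactor-omex-< s+1<k) ⟩
    (mono (s ℕ.* suc s) · invqPoch s) · ((mono (suc s) · geom 1ℤ s) · mono (suc s))
      ≈⟨ solve 5 (λ a i b g c → (a ⊛ i) ⊛ ((b ⊛ g) ⊛ c) ⊜ ((a ⊛ b) ⊛ c) ⊛ (i ⊛ g)) ≈-refl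
               (mono (s ℕ.* suc s)) (invqPoch s) (mono (suc s)) (geom 1ℤ s) (mono (suc s)) ⟩
    ((mono (s ℕ.* suc s) · mono (suc s)) · mono (suc s)) · invqPoch (suc s)
      ≈⟨ ·-congˡ (invqPoch (suc s))
                 (≈-trans (mono-+-+ (s ℕ.* suc s) (suc s) (suc s)) (≈-reflexive (cong mono (arith s)))) ⟩
    mono (suc s ℕ.* suc (suc s)) · invqPoch (suc s) ∎
    where
    arith : ∀ s → s ℕ.* suc s ℕ.+ suc s ℕ.+ suc s ≡ suc s ℕ.* suc (suc s)
    arith = ℕ-Solver.solve-∀

module _ (m : ℕ) where

  private
    π : Profile
    π = omexProfile (suc m , true)

  open ·-Solver using (solve; _⊜_) renaming (_⊕_ to _⊛_; id to ε)
  open ≈-Reasoning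

  gfUpTo-omex-≡ : gfUpTo π (suc m) ≈ mono (suc m ℕ.* suc m) · invqPoch (suc m)
  gfUpTo-omex-≡ = begin
    gfUpTo π m · sizeFactor π m
      ≈⟨ ·-cong (gfUpTo-omex-< m ℕP.≤-refl) (sizeFactor-omex-≡ m) ⟩
    (mono (m ℕ.* suc m) · invqPoch m) · ((mono (suc m) · geom 1ℤ m) · oneS)
      ≈⟨ solve 4 (λ a i b g → (a ⊛ i) ⊛ ((b ⊛ g) ⊛ ε) ⊜ (a ⊛ b) ⊛ (i ⊛ g)) ≈-refl
               (mono (m ℕ.* suc m)) (invqPoch m) (mono (suc m)) (geom 1ℤ m) ⟩
    (mono (m ℕ.* suc m) · mono (suc m)) · invqPoch (suc m)
      ≈⟨ ·-congˡ (invqPoch (suc m))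
                 (≈-trans (≈-sym (mono-+ (m ℕ.* suc m) (suc m))) (≈-reflexive (cong mono (arith m)))) ⟩
    mono (suc m ℕ.* suc m) · invqPoch (suc m) ∎
    where
    arith : ∀ m → m ℕ.* suc m ℕ.+ suc m ≡ suc m ℕ.* suc m
    arith = ℕ-Solver.solve-∀

  gfUpTo-omex-≥ : ∀ {n} → suc m ≤ n →
                  gfUpTo π n · negqPoch (suc m) ≈ (mono (suc m ℕ.* suc m) · invqPoch n) · negqPoch n
  gfUpTo-omex-≥ {n} k≤n with ℕP.m≤n⇒m<n∨m≡n k≤n
  ... | inj₂ refl = ·-congˡ (negqPoch (suc m)) gfUpTo-omex-≡
  gfUpTo-omex-≥ {suc n} _ | inj₁ (s≤s k≤n) = begin
    (gfUpTo π n · sizeFactor π n) · negqPoch (suc m)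
      ≈⟨ ·-congˡ (negqPoch (suc m)) (·-congʳ (gfUpTo π n) (sizeFactor-omex-> (s≤s k≤n))) ⟩
    (gfUpTo π n · (geom 1ℤ n · onePlus 1ℤ n)) · negqPoch (suc m)
      ≈⟨ solve 4 (λ u g o p → (u ⊛ (g ⊛ o)) ⊛ p ⊜ (u ⊛ p) ⊛ (g ⊛ o)) ≈-refl
               (gfUpTo π n) (geom 1ℤ n) (onePlus 1ℤ n) (negqPoch (suc m)) ⟩
    (gfUpTo π n · negqPoch (suc m)) · (geom 1ℤ n · onePlus 1ℤ n)
      ≈⟨ ·-congˡ (geom 1ℤ n · onePlus 1ℤ n) (gfUpTo-omex-≥ k≤n) ⟩
    ((mono (suc m ℕ.* suc m) · invqPoch n) · negqPoch n) · (geom 1ℤ n · onePlus 1ℤ n)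
      ≈⟨ solve 5 (λ a i p g o → ((a ⊛ i) ⊛ p) ⊛ (g ⊛ o) ⊜ (a ⊛ (i ⊛ g)) ⊛ (p ⊛ o)) ≈-refl
               (mono (suc m ℕ.* suc m)) (invqPoch n) (negqPoch n) (geom 1ℤ n) (onePlus 1ℤ n) ⟩
    (mono (suc m ℕ.* suc m) · invqPoch (suc n)) · negqPoch (suc n) ∎

  gfUpTo-omex : ∀ {n} → suc m ≤ n →
                (negqPoch n · invqPoch n) · (mono (suc m ℕ.* suc m) · invNegqPoch (suc m)) ≈ gfUpTo π n
  gfUpTo-omex {n} k≤n = begin
    (negqPoch n · invqPoch n) · (mono (suc m ℕ.* suc m) · invNegqPoch (suc m))
      ≈⟨ solve 4 (λ p i a v → (p ⊛ i) ⊛ (a ⊛ v) ⊜ ((a ⊛ i) ⊛ p) ⊛ v) ≈-refl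
               (negqPoch n) (invqPoch n) (mono (suc m ℕ.* suc m)) (invNegqPoch (suc m)) ⟩
    ((mono (suc m ℕ.* suc m) · invqPoch n) · negqPoch n) · invNegqPoch (suc m)
      ≈⟨ ·-congˡ (invNegqPoch (suc m)) (gfUpTo-omex-≥ k≤n) ⟨
    (gfUpTo π n · negqPoch (suc m)) · invNegqPoch (suc m)
      ≈⟨ ·-assoc (gfUpTo π n) (negqPoch (suc m)) (invNegqPoch (suc m)) ⟩
    gfUpTo π n · (negqPoch (suc m) · invNegqPoch (suc m))
      ≈⟨ ·-congʳ (gfUpTo π n) (negqPoch-·-invNegqPoch (suc m)) ⟩
    gfUpTo π n · oneS
      ≈⟨ ·-identityʳ (gfUpTo π n) ⟩
    gfUpTo π n ∎

mockTerm : ℕ → PS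
mockTerm m = shift (m ℕ.* m) (invNegqPoch m)

Pbar-·-mockTerm : ∀ m {n} → suc m ≤ n → (Pbar · mockTerm (suc m)) n ≡ gfUpTo (omexProfile (suc m , true)) n n
Pbar-·-mockTerm m {n} k≤n =
  trans (coeff≤ (·-cong-≈[] (Pbar-≈[] n) (≈⇒≈[] n mockTerm≈)) ℕP.≤-refl) (coeff (gfUpTo-omex m k≤n) n)
  where
  mockTerm≈ : mockTerm (suc m) ≈ mono (suc m ℕ.* suc m) · invNegqPoch (suc m)
  mockTerm≈ = ≈-sym (mono-· (suc m ℕ.* suc m) (invNegqPoch (suc m)))

f0⊖oneS-≈[] : ∀ n → f0 ⊖ oneS ≈[ n ] (λ j → sumBelow (λ m → mockTerm (suc m) j) n)
f0⊖oneS-≈[] n = coeffwise≤ λ {j} j≤n → begin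
  f0 j - oneS j                                        ≡⟨ cong (_- oneS j) (sumBelow-suc (λ m → mockTerm m j) j) ⟩
  oneS j + sumBelow (λ m → mockTerm (suc m) j) j - oneS j ≡⟨ cancel (oneS j) _ ⟩
  sumBelow (λ m → mockTerm (suc m) j) j                ≡⟨ sumBelow-vanishing (λ m → mockTerm (suc m) j) j≤n vanish ⟨
  sumBelow (λ m → mockTerm (suc m) j) n                ∎
  where
  open ≡-Reasoning
  cancel : ∀ a x → a + x - a ≡ x
  cancel = solve-∀
  vanish : ∀ {j i} → j ≤ i → mockTerm (suc i) j ≡ 0ℤ
  vanish {j} {i} j≤i = shift-< (invNegqPoch (suc i)) (ℕP.<-≤-trans (s≤s j≤i) (ℕP.m≤m*n (suc i) (suc i)))

rhs-expansion : ∀ n → rhs n ≡ sumBelow (λ m → gfUpTo (omexProfile (suc m , true)) n n) n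
rhs-expansion n = begin
  rhs n
    ≡⟨ coeff≤ (·-cong-≈[] (≈[]-refl {Pbar}) (f0⊖oneS-≈[] n)) ℕP.≤-refl ⟩
  (Pbar · (λ j → sumBelow (λ m → mockTerm (suc m) j) n)) n
    ≡⟨ coeff (·-sumBelow Pbar (mockTerm ∘ suc) n) n ⟩
  sumBelow (λ m → (Pbar · mockTerm (suc m)) n) n
    ≡⟨ sumBelow-cong n (λ {m} m<n → Pbar-·-mockTerm m m<n) ⟩
  sumBelow (λ m → gfUpTo (omexProfile (suc m , true)) n n) n ∎
  where open ≡-Reasoning

theorem2p3 : (n : ℕ) → Σ ℕ (λ c → HasCardinality (MTildeSet n) c × (rhs n ≡ + c))
theorem2p3 n =
  counted-≡ (sym (rhs-expansion n))
    (counted-⇔ (λ _ → OmexAdmissible⇒MTildeSet) (λ _ → MTildeSet⇒OmexAdmissible)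
      (counted-⋃ (OmexAdmissible n) (λ m → gfUpTo (omexProfile (suc m , true)) n n) n
                 (λ {m} _ → counted-Admissible (omexProfile (suc m , true)) n n) OmexAdmissible-unique))
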